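{- Let $D$, $m$ and $n$ be non-zero integers. For each solution $(x, y)$ to the congruence equations \begin{align*} x^2 &\equiv D \ ( \mathrm{mod} \ 4m) \ \text{for} \ 0\leq x \leq 2 |m| -1, \\ y^2 &\equiv D \ ( \mathrm{mod} \ 4n ) \ \text{for} \ 0\leq y \leq 2 |n| -1, \end{align*} there exists a $2\times 2\times2$ integer cube $A$ such that \begin{align*} \mathrm{disc}(A) &= D , \\ Q_1(A)(u,v) & = mu^2+ x uv+ sv^2, \\ Q_2(A)(u,v) &=n u^2+ y uv + t v^2 \end{align*} for some integers $s,t$. Moreover, the required $2 \times 2 \times 2$ integer cube $A$ can be chosen such that in the bottom side $A^D=\left(\begin{smallmatrix} c&g\\ d&h\end{smallmatrix}\right)$ of $A$ one has $c =0$ and $\gcd( d, g, h) =1$.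
   Context: A $2\times2\times2$ integer cube is written $A = \left( \left( \begin{smallmatrix} a & b \\ c & d \end{smallmatrix} \right), \left( \begin{smallmatrix} e & f \\ g & h \end{smallmatrix} \right) \right)$. Its associated binary quadratic forms are $Q_1(A)(u,v)=u^2(ad-bc)+uv(-ah+bg+cf-de)+v^2(eh-fg)$ and $Q_2(A)(u,v)=u^2(ag-ce)+uv(-ah-bg+cf+de)+v^2(bh-df)$, and $\mathrm{disc}(A)=(-ah+bg+cf-de)^2-4(ad-bc)(eh-fg)$ (the common discriminant of these forms). -}

module Defs where

open import Data.Integer using (ℤ; _+_; _-_; _*_; -_; +_)
open import Data.Product using (_×_; _,_)

-- A 2×2×2 integer cube A = ((a b ; c d) , (e f ; g h))
record Cube : Set where
  constructor cube
  field
    a b c d e f g h : ℤ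

-- Binary quadratic form  α u² + β uv + γ v²  as its coefficient triple (α , β , γ)
BQF : Set
BQF = ℤ × ℤ × ℤ

Q₁ : Cube → BQF
Q₁ (cube a b c d e f g h) =
  (a * d - b * c) , ((- (a * h)) + b * g + c * f - d * e) , (e * h - f * g)

Q₂ : Cube → BQF
Q₂ (cube a b c d e f g h) =
  (a * g - c * e) , ((- (a * h)) - b * g + c * f + d * e) , (b * h - d * f)

disc : Cube → ℤ
disc (cube a b c d e f g h) =
  ((- (a * h)) + b * g + c * f - d * e) * ((- (a * h)) + b * g + c * f - d * e)
  - (+ 4) * (a * d - b * c) * (e * h - f * g)

{-# OPTIONS --safe #-}
-- Write 4 m s = x² - D and 4 n t = y² - D. As x² ≡ y² (mod 4), x and y have the same parity,
-- so δ = (x - y)/2 and τ = -(x + y)/2 are integers with x = δ - τ and y = -τ - δ. Factor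
-- (m, n, τ) = a (d, g, h) with a = gcd(m, n, τ), making (d, g, h) primitive, and take it as the
-- bottom face (c = 0). Then Q₁ = (a d, -a h + (b g - d e), e h - f g) and
-- Q₂ = (a g, -a h - (b g - d e), b h - d f), so b, e, f must satisfy three linear equations;
-- they are consistent because x² - y² = -4 τ δ gives h δ + s d = g t, and solvable over ℤ
-- because (d, g, h) is primitive. The discriminant of A is that of Q₁, i.e. x² - 4 m s = D.
module Submission where

open import Defs
import Data.Nat as ℕ
import Data.Nat.Divisibility as ℕ
open import Data.Nat.GCD using (gcd-GCD; module Bézout)
open import Data.Nat.Primality using (Prime; prime?; euclidsLemma)
open import Data.Integer using (ℤ; _+_; _-_; _*_; -_; +_; ∣_∣; _≤_; 0ℤ; 1ℤ; -1ℤ; ≢-nonZero)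
open import Data.Integer.Properties
  using (+∣i∣≡i⊎+∣i∣≡-i; pos-*; abs-*; *-identityˡ; -1*i≡-i; +-comm; *-comm; *-cancelˡ-≡)
open import Data.Integer.Divisibility using (_∣_)
open import Data.Integer.Divisibility.Signed as Signed
  using (divides; ∣ᵤ⇒∣; ∣⇒∣ᵤ; ∣-refl; ∣-trans; ∣m∣n⇒∣m+n; ∣m∣n⇒∣m-n; ∣n⇒∣m*n; ∣m⇒∣m*n)
open import Data.Integer.GCD using (gcd; gcd[i,j]∣i; gcd[i,j]∣j; gcd[i,j]≡0⇒i≡0)
open import Data.Integer.Tactic.RingSolver using (solve)
open import Data.List using (_∷_; [])
open import Data.Product using (Σ; ∃; ∃₂; _×_; _,_)
open import Data.Sum using (inj₁; inj₂; reduce)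
open import Relation.Nullary.Decidable using (from-yes)
open import Relation.Binary.PropositionalEquality
  using (_≡_; _≢_; refl; sym; trans; cong; cong₂; subst; module ≡-Reasoning)

open ≡-Reasoning

prime∣i*i⇒prime∣i : ∀ {p} → Prime p → ∀ i → + p ∣ i * i → + p ∣ i
prime∣i*i⇒prime∣i p-prime i p∣i*i =
  reduce (euclidsLemma ∣ i ∣ ∣ i ∣ p-prime (subst (_ ℕ.∣_) (abs-* i i) p∣i*i))

2∣i*i-j*j⇒2∣i-j : ∀ i j → + 2 Signed.∣ i * i - j * j → + 2 Signed.∣ i - j
2∣i*i-j*j⇒2∣i-j i j 2∣i²-j² =
  ∣ᵤ⇒∣ (prime∣i*i⇒prime∣i (from-yes (prime? 2)) (i - j) (∣⇒∣ᵤ 2∣[i-j]²))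
  where
  [i-j]²≡ : i * i - j * j - + 2 * (j * (i - j)) ≡ (i - j) * (i - j)
  [i-j]²≡ = solve (i ∷ j ∷ [])
  2∣[i-j]² : + 2 Signed.∣ (i - j) * (i - j)
  2∣[i-j]² = subst (+ 2 Signed.∣_) [i-j]²≡ (∣m∣n⇒∣m-n 2∣i²-j² (∣m⇒∣m*n _ ∣-refl))

square-roots-mod-4-same-parity : ∀ {D x y} → + 4 Signed.∣ x * x - D → + 4 Signed.∣ y * y - D →
  + 2 Signed.∣ x - y
square-roots-mod-4-same-parity {D} {x} {y} 4∣x²-D 4∣y²-D =
  2∣i*i-j*j⇒2∣i-j x y
    (∣-trans (divides (+ 2) refl) (subst (+ 4 Signed.∣_) difference 4∣difference))
  where
  4∣difference : + 4 Signed.∣ (x * x - D) - (y * y - D)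
  4∣difference = ∣m∣n⇒∣m-n 4∣x²-D 4∣y²-D
  difference : (x * x - D) - (y * y - D) ≡ x * x - y * y
  difference = solve (D ∷ x ∷ y ∷ [])

+∣i∣≡±i : ∀ i → ∃ λ ε → + ∣ i ∣ ≡ ε * i
+∣i∣≡±i i with +∣i∣≡i⊎+∣i∣≡-i i
... | inj₁ ∣i∣≡i  = 1ℤ , trans ∣i∣≡i (sym (*-identityˡ i))
... | inj₂ ∣i∣≡-i = -1ℤ , trans ∣i∣≡-i (sym (-1*i≡-i i))

cast-identity : ∀ {d m n} x y → d ℕ.+ y ℕ.* n ≡ x ℕ.* m → + d + + y * + n ≡ + x * + m
cast-identity {d} {m} {n} x y eq = begin
  + d + + y * + n    ≡⟨ cong (_+_ (+ d)) (sym (pos-* y n)) ⟩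
  + (d ℕ.+ y ℕ.* n)  ≡⟨ cong +_ eq ⟩
  + (x ℕ.* m)        ≡⟨ pos-* x m ⟩
  + x * + m          ∎

identity-with-signs : ∀ {g M N} X Y ε η i j → g + Y * N ≡ X * M → M ≡ ε * i → N ≡ η * j →
  g ≡ X * ε * i + - (Y * η) * j
identity-with-signs {g} {M} {N} X Y ε η i j eq M≡εi N≡ηj = begin
  g                             ≡⟨ solve (g ∷ Y ∷ N ∷ []) ⟩
  (g + Y * N) - Y * N           ≡⟨ cong (_- Y * N) eq ⟩
  X * M - Y * N                 ≡⟨ cong₂ (λ M N → X * M - Y * N) M≡εi N≡ηj ⟩
  X * (ε * i) - Y * (η * j)     ≡⟨ solve (X ∷ Y ∷ ε ∷ η ∷ i ∷ j ∷ []) ⟩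
  X * ε * i + - (Y * η) * j     ∎

bézout : ∀ i j → ∃₂ λ u v → gcd i j ≡ u * i + v * j
bézout i j with Bézout.identity (gcd-GCD ∣ i ∣ ∣ j ∣) | +∣i∣≡±i i | +∣i∣≡±i j
... | Bézout.+- x y eq | ε , ∣i∣≡εi | η , ∣j∣≡ηj =
  + x * ε , - (+ y * η) ,
  identity-with-signs (+ x) (+ y) ε η i j (cast-identity x y eq) ∣i∣≡εi ∣j∣≡ηj
... | Bézout.-+ x y eq | ε , ∣i∣≡εi | η , ∣j∣≡ηj =
  - (+ x * ε) , + y * η ,
  trans (identity-with-signs (+ y) (+ x) η ε j i (cast-identity y x eq) ∣j∣≡ηj ∣i∣≡εi)
        (+-comm (+ y * η * j) (- (+ x * ε) * i))

bézout₃ : ∀ i j k → ∃₂ λ u v → ∃ λ w → gcd (gcd i j) k ≡ u * i + v * j + w * k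
bézout₃ i j k with bézout (gcd i j) k | bézout i j
... | u , w , gcd₃≡ | u′ , v′ , gcd≡ = u * u′ , u * v′ , w , (begin
  gcd (gcd i j) k                  ≡⟨ gcd₃≡ ⟩
  u * gcd i j + w * k              ≡⟨ cong (λ g → u * g + w * k) gcd≡ ⟩
  u * (u′ * i + v′ * j) + w * k    ≡⟨ solve (i ∷ j ∷ k ∷ u ∷ w ∷ u′ ∷ v′ ∷ []) ⟩
  u * u′ * i + u * v′ * j + w * k  ∎)

cofactors-unimodular : ∀ {a i j k i′ j′ k′ u v w} → a ≢ 0ℤ →
  i ≡ i′ * a → j ≡ j′ * a → k ≡ k′ * a → a ≡ u * i + v * j + w * k →
  u * i′ + v * j′ + w * k′ ≡ 1ℤ
cofactors-unimodular {a} {i} {j} {k} {i′} {j′} {k′} {u} {v} {w} a≢0 i≡ j≡ k≡ a≡ =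
  *-cancelˡ-≡ a _ _ {{≢-nonZero a≢0}} (begin
    a * (u * i′ + v * j′ + w * k′)
      ≡⟨ solve (a ∷ i′ ∷ j′ ∷ k′ ∷ u ∷ v ∷ w ∷ []) ⟩
    u * (i′ * a) + v * (j′ * a) + w * (k′ * a)
      ≡⟨ cong₂ (λ I J → u * I + v * J + w * (k′ * a)) (sym i≡) (sym j≡) ⟩
    u * i + v * j + w * (k′ * a)
      ≡⟨ cong (λ K → u * i + v * j + w * K) (sym k≡) ⟩
    u * i + v * j + w * k
      ≡⟨ sym a≡ ⟩
    a
      ≡⟨ solve (a ∷ []) ⟩
    a * 1ℤ ∎)

Unimodular : ℤ → ℤ → ℤ → Set
Unimodular d g h = ∃₂ λ u v → ∃ λ w → u * d + v * g + w * h ≡ 1ℤ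

unimodular⇒gcd₃≡1 : ∀ {d g h} → Unimodular d g h → gcd (gcd d g) h ≡ 1ℤ
unimodular⇒gcd₃≡1 {d} {g} {h} (u , v , w , unimodular) = cong +_ (ℕ.∣1⇒≡1 (∣⇒∣ᵤ G∣1))
  where
  G = gcd (gcd d g) h
  G∣1 : G Signed.∣ 1ℤ
  G∣1 = subst (G Signed.∣_) unimodular (∣m∣n⇒∣m+n (∣m∣n⇒∣m+n
    (∣n⇒∣m*n u (∣ᵤ⇒∣ (ℕ.∣-trans (gcd[i,j]∣i (gcd d g) h) (gcd[i,j]∣i d g))))
    (∣n⇒∣m*n v (∣ᵤ⇒∣ (ℕ.∣-trans (gcd[i,j]∣i (gcd d g) h) (gcd[i,j]∣j d g)))))
    (∣n⇒∣m*n w (∣ᵤ⇒∣ (gcd[i,j]∣j (gcd d g) h))))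

PrimitiveDecomposition : ℤ → ℤ → ℤ → Set
PrimitiveDecomposition i j k =
  ∃ λ a → a ≢ 0ℤ × ∃₂ λ d g → ∃ λ h → i ≡ d * a × j ≡ g * a × k ≡ h * a × Unimodular d g h

primitive-decomposition : ∀ i j k → i ≢ 0ℤ → PrimitiveDecomposition i j k
primitive-decomposition i j k i≢0 = decompose (bézout₃ i j k)
  where
  a = gcd (gcd i j) k
  a≢0 : a ≢ 0ℤ
  a≢0 a≡0 = i≢0 (gcd[i,j]≡0⇒i≡0 i j (gcd[i,j]≡0⇒i≡0 (gcd i j) k a≡0))
  open Signed._∣_ (∣ᵤ⇒∣ {a} {i} (ℕ.∣-trans (gcd[i,j]∣i (gcd i j) k) (gcd[i,j]∣i i j)))
    renaming (quotient to d; equality to i≡da)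
  open Signed._∣_ (∣ᵤ⇒∣ {a} {j} (ℕ.∣-trans (gcd[i,j]∣i (gcd i j) k) (gcd[i,j]∣j i j)))
    renaming (quotient to g; equality to j≡ga)
  open Signed._∣_ (∣ᵤ⇒∣ {a} {k} (gcd[i,j]∣j (gcd i j) k))
    renaming (quotient to h; equality to k≡ha)
  decompose : (∃₂ λ u v → ∃ λ w → a ≡ u * i + v * j + w * k) → PrimitiveDecomposition i j k
  decompose (u , v , w , a≡) = a , a≢0 , d , g , h , i≡da , j≡ga , k≡ha ,
    (u , v , w , cofactors-unimodular {i′ = d} {g} {h} {u} {v} {w} a≢0 i≡da j≡ga k≡ha a≡)

discriminant : BQF → ℤ
discriminant (α , β , γ) = β * β - + 4 * α * γ

disc≡discriminant∘Q₁ : ∀ A → disc A ≡ discriminant (Q₁ A)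
disc≡discriminant∘Q₁ (cube a b c d e f g h) = refl

x²-D≡4ms⇒discriminant≡D : ∀ {D m x s} → x * x - D ≡ s * (+ 4 * m) → discriminant (m , x , s) ≡ D
x²-D≡4ms⇒discriminant≡D {D} {m} {x} {s} eq = begin
  x * x - + 4 * m * s             ≡⟨ solve (D ∷ m ∷ x ∷ s ∷ []) ⟩
  D + (x * x - D - s * (+ 4 * m)) ≡⟨ cong (λ r → D + (x * x - D - r)) (sym eq) ⟩
  D + (x * x - D - (x * x - D))   ≡⟨ solve (D ∷ x ∷ []) ⟩
  D ∎

-- (b, e, f) solves b g - d e = δ, e h - f g = s, b h - d f = t; it is built from the row (u, v, w).
module Completion (a d g h s t δ : ℤ) {u v w : ℤ}
  (unimodular : u * d + v * g + w * h ≡ 1ℤ) (compatible : h * δ + s * d ≡ g * t) where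

  completion : Cube
  completion = cube a (δ * v + w * t) 0ℤ d (s * w - δ * u) (- (u * t) - s * v) g h

  private
    cancel-relations : ∀ α β → α * (u * d + v * g + w * h) + β * (g * t - (h * δ + s * d)) ≡ α
    cancel-relations α β = begin
      α * (u * d + v * g + w * h) + β * (g * t - (h * δ + s * d))
        ≡⟨ cong₂ (λ X Y → α * X + β * (g * t - Y)) unimodular compatible ⟩
      α * 1ℤ + β * (g * t - g * t)
        ≡⟨ solve (α ∷ β ∷ g ∷ t ∷ []) ⟩
      α ∎

  Q₁-completion : Q₁ completion ≡ (a * d , δ - a * h , s)
  Q₁-completion = cong₂ _,_ left (cong₂ _,_ middle right)
    where
    left : a * d - (δ * v + w * t) * 0ℤ ≡ a * d
    left = solve (a ∷ d ∷ t ∷ v ∷ w ∷ δ ∷ [])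
    middle : - (a * h) + (δ * v + w * t) * g + 0ℤ * (- (u * t) - s * v) - d * (s * w - δ * u)
           ≡ δ - a * h
    middle = begin
      - (a * h) + (δ * v + w * t) * g + 0ℤ * (- (u * t) - s * v) - d * (s * w - δ * u)
        ≡⟨ solve (a ∷ d ∷ g ∷ h ∷ s ∷ t ∷ u ∷ v ∷ w ∷ δ ∷ []) ⟩
      δ * (u * d + v * g + w * h) + w * (g * t - (h * δ + s * d)) - a * h
        ≡⟨ cong (_- a * h) (cancel-relations δ w) ⟩
      δ - a * h ∎
    right : (s * w - δ * u) * h - (- (u * t) - s * v) * g ≡ s
    right = begin
      (s * w - δ * u) * h - (- (u * t) - s * v) * g
        ≡⟨ solve (d ∷ g ∷ h ∷ s ∷ t ∷ u ∷ v ∷ w ∷ δ ∷ []) ⟩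
      s * (u * d + v * g + w * h) + u * (g * t - (h * δ + s * d))
        ≡⟨ cancel-relations s u ⟩
      s ∎

  Q₂-completion : Q₂ completion ≡ (a * g , - (a * h) - δ , t)
  Q₂-completion = cong₂ _,_ left (cong₂ _,_ middle right)
    where
    left : a * g - 0ℤ * (s * w - δ * u) ≡ a * g
    left = solve (a ∷ g ∷ s ∷ u ∷ w ∷ δ ∷ [])
    middle : - (a * h) - (δ * v + w * t) * g + 0ℤ * (- (u * t) - s * v) + d * (s * w - δ * u)
           ≡ - (a * h) - δ
    middle = begin
      - (a * h) - (δ * v + w * t) * g + 0ℤ * (- (u * t) - s * v) + d * (s * w - δ * u)
        ≡⟨ solve (a ∷ d ∷ g ∷ h ∷ s ∷ t ∷ u ∷ v ∷ w ∷ δ ∷ []) ⟩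
      - (a * h) - (δ * (u * d + v * g + w * h) + w * (g * t - (h * δ + s * d)))
        ≡⟨ cong (λ r → - (a * h) - r) (cancel-relations δ w) ⟩
      - (a * h) - δ ∎
    right : (δ * v + w * t) * h - d * (- (u * t) - s * v) ≡ t
    right = begin
      (δ * v + w * t) * h - d * (- (u * t) - s * v)
        ≡⟨ solve (d ∷ g ∷ h ∷ s ∷ t ∷ u ∷ v ∷ w ∷ δ ∷ []) ⟩
      t * (u * d + v * g + w * h) + (- v) * (g * t - (h * δ + s * d))
        ≡⟨ cancel-relations t (- v) ⟩
      t ∎

roots-compatible : ∀ {D m n x y s t δ τ} → x ≡ δ - τ → y ≡ - τ - δ →
  x * x - D ≡ s * (+ 4 * m) → y * y - D ≡ t * (+ 4 * n) → τ * δ + s * m ≡ t * n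
roots-compatible {D} {m} {n} {x} {y} {s} {t} {δ} {τ} x≡ y≡ x²-D≡ y²-D≡ =
  *-cancelˡ-≡ (+ 4) _ _ (begin
    + 4 * (τ * δ + s * m)                 ≡⟨ solve (m ∷ s ∷ δ ∷ τ ∷ []) ⟩
    + 4 * τ * δ + s * (+ 4 * m)           ≡⟨ cong (λ r → + 4 * τ * δ + r) (sym x²-D≡) ⟩
    + 4 * τ * δ + (x * x - D)             ≡⟨ cong (λ x → + 4 * τ * δ + (x * x - D)) x≡ ⟩
    + 4 * τ * δ + ((δ - τ) * (δ - τ) - D) ≡⟨ solve (D ∷ δ ∷ τ ∷ []) ⟩
    (- τ - δ) * (- τ - δ) - D             ≡⟨ cong (λ y → y * y - D) (sym y≡) ⟩
    y * y - D                             ≡⟨ y²-D≡ ⟩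
    t * (+ 4 * n)                         ≡⟨ solve (n ∷ t ∷ []) ⟩
    + 4 * (t * n)                         ∎)

cofactors-compatible : ∀ {a m n τ d g h s t δ} → a ≢ 0ℤ → m ≡ d * a → n ≡ g * a → τ ≡ h * a →
  τ * δ + s * m ≡ t * n → h * δ + s * d ≡ g * t
cofactors-compatible {a} {m} {n} {τ} {d} {g} {h} {s} {t} {δ} a≢0 m≡ n≡ τ≡ compatible =
  *-cancelˡ-≡ a _ _ {{≢-nonZero a≢0}} (begin
    a * (h * δ + s * d)       ≡⟨ solve (a ∷ d ∷ h ∷ s ∷ δ ∷ []) ⟩
    h * a * δ + s * (d * a)   ≡⟨ cong₂ (λ τ m → τ * δ + s * m) (sym τ≡) (sym m≡) ⟩
    τ * δ + s * m             ≡⟨ compatible ⟩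
    t * n                     ≡⟨ cong (t *_) n≡ ⟩
    t * (g * a)               ≡⟨ solve (a ∷ g ∷ t ∷ []) ⟩
    a * (g * t)               ∎)

realising-cube : ∀ {D m n x y s t δ} →
  x - y ≡ δ * + 2 → x * x - D ≡ s * (+ 4 * m) → y * y - D ≡ t * (+ 4 * n) →
  PrimitiveDecomposition m n (- (y + δ)) →
  Σ Cube λ A → disc A ≡ D × Q₁ A ≡ (m , x , s) × Q₂ A ≡ (n , y , t)
    × Cube.c A ≡ 0ℤ × gcd (gcd (Cube.d A) (Cube.g A)) (Cube.h A) ≡ 1ℤ
realising-cube {D} {m} {n} {x} {y} {s} {t} {δ} x-y≡2δ x²-D≡4ms y²-D≡4nt
  (a , a≢0 , d , g , h , m≡da , n≡ga , τ≡ha , unimodular@(u , v , w , u*d+v*g+w*h≡1)) =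
  completion , disc≡D , Q₁≡ , Q₂≡ , refl , unimodular⇒gcd₃≡1 {d} {g} {h} unimodular
  where
  x≡δ-τ : x ≡ δ - - (y + δ)
  x≡δ-τ = begin
    x              ≡⟨ solve (x ∷ y ∷ []) ⟩
    y + (x - y)    ≡⟨ cong (_+_ y) x-y≡2δ ⟩
    y + δ * + 2    ≡⟨ solve (y ∷ δ ∷ []) ⟩
    δ - - (y + δ)  ∎
  y≡-τ-δ : y ≡ - - (y + δ) - δ
  y≡-τ-δ = solve (y ∷ δ ∷ [])
  open Completion a d g h s t δ {u} {v} {w} u*d+v*g+w*h≡1
    (cofactors-compatible {g = g} {h} {s} {t} {δ} a≢0 m≡da n≡ga τ≡ha
      (roots-compatible {s = s} {t} {δ} {τ = - (y + δ)} x≡δ-τ y≡-τ-δ x²-D≡4ms y²-D≡4nt))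
  a*h≡τ : a * h ≡ - (y + δ)
  a*h≡τ = trans (*-comm a h) (sym τ≡ha)
  Q₁≡ : Q₁ completion ≡ (m , x , s)
  Q₁≡ = trans Q₁-completion (cong₂ _,_ (trans (*-comm a d) (sym m≡da))
    (cong (_, s) (trans (cong (λ r → δ - r) a*h≡τ) (sym x≡δ-τ))))
  Q₂≡ : Q₂ completion ≡ (n , y , t)
  Q₂≡ = trans Q₂-completion (cong₂ _,_ (trans (*-comm a g) (sym n≡ga))
    (cong (_, t) (trans (cong (λ r → - r - δ) a*h≡τ) (sym y≡-τ-δ))))
  disc≡D : disc completion ≡ D
  disc≡D = trans (disc≡discriminant∘Q₁ completion)
    (trans (cong discriminant Q₁≡) (x²-D≡4ms⇒discriminant≡D {D} {m} {x} {s} x²-D≡4ms))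

lemma3p3 : (D m n : ℤ) → D ≢ 0ℤ → m ≢ 0ℤ → n ≢ 0ℤ →
    (x y : ℤ) →
    (+ 4) * m ∣ (x * x - D) → 0ℤ ≤ x → x ≤ (+ 2) * (+ ∣ m ∣) - 1ℤ →
    (+ 4) * n ∣ (y * y - D) → 0ℤ ≤ y → y ≤ (+ 2) * (+ ∣ n ∣) - 1ℤ →
    Σ Cube (λ A → Σ ℤ (λ s → Σ ℤ (λ t →
      disc A ≡ D
      × Q₁ A ≡ (m , x , s)
      × Q₂ A ≡ (n , y , t)
      × Cube.c A ≡ 0ℤ
      × gcd (gcd (Cube.d A) (Cube.g A)) (Cube.h A) ≡ 1ℤ)))
lemma3p3 D m n _ m≢0 _ x y 4m∣x²-D _ _ 4n∣y²-D _ _ =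
  let A , properties = realising-cube {D} {m} {n} {x} {y} {s} {t} {δ} x-y≡2δ x²-D≡4ms y²-D≡4nt
                         (primitive-decomposition m n (- (y + δ)) m≢0)
  in A , s , t , properties
  where
  4m∣x²-D′ : + 4 * m Signed.∣ x * x - D
  4m∣x²-D′ = ∣ᵤ⇒∣ 4m∣x²-D
  4n∣y²-D′ : + 4 * n Signed.∣ y * y - D
  4n∣y²-D′ = ∣ᵤ⇒∣ 4n∣y²-D
  2∣x-y : + 2 Signed.∣ x - y
  2∣x-y = square-roots-mod-4-same-parity {D} {x} {y}
    (∣-trans (∣m⇒∣m*n m ∣-refl) 4m∣x²-D′) (∣-trans (∣m⇒∣m*n n ∣-refl) 4n∣y²-D′)
  open Signed._∣_ 4m∣x²-D′ renaming (quotient to s; equality to x²-D≡4ms)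
  open Signed._∣_ 4n∣y²-D′ renaming (quotient to t; equality to y²-D≡4nt)
  open Signed._∣_ 2∣x-y renaming (quotient to δ; equality to x-y≡2δ)
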